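{- $\operatorname{im}(P_6\,\Box\, P_6)=5$.
   Context: All graphs are finite and simple. $P_6$ is the path on 6 vertices. A graph $G$ has a $G'$-immersion if there is an injective map $\phi:V(G')\to V(G)$ such that for every edge $uv\in E(G')$ there is a path in $G$ joining $\phi(u)$ and $\phi(v)$, and these paths are pairwise edge-disjoint. The immersion number $\operatorname{im}(G)$ is the largest $t$ such that $G$ has a $K_t$-immersion. The Cartesian product $G\,\Box\, H$ has vertex set $V(G)\times V(H)$, with $(g,h)$ adjacent to $(g',h')$ iff $g=g'$ and $hh'\in E(H)$, or $gg'\in E(G)$ and $h=h'$. -}

module Defs where

open import Data.Nat using (ℕ; suc; _≤_)
open import Data.Fin using (Fin; toℕ; _<_)
open import Data.List using (List; []; _∷_)
open import Data.List.Membership.Propositional using (_∈_)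
open import Data.List.Relation.Unary.Unique.Propositional using (Unique)
open import Data.Product using (_×_; _,_)
open import Data.Sum using (_⊎_)
open import Relation.Nullary using (¬_)
open import Relation.Binary.PropositionalEquality using (_≡_; _≢_)
open import Function.Definitions using (Injective)

record Graph : Set₁ where
  field
    V      : Set
    Adj    : V → V → Set
    adj-sym : ∀ {u v} → Adj u v → Adj v u
    irrefl : ∀ {u} → ¬ Adj u u
open Graph public

PathAdj : ∀ {n} → Fin n → Fin n → Set
PathAdj i j = (toℕ j ≡ suc (toℕ i)) ⊎ (toℕ i ≡ suc (toℕ j))

PathGraph : ℕ → Graph
PathGraph n = record
  { V = Fin n
  ; Adj = PathAdj
  ; adj-sym = λ { (Data.Sum.inj₁ e) → Data.Sum.inj₂ e ; (Data.Sum.inj₂ e) → Data.Sum.inj₁ e }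
  ; irrefl = irr
  }
  where
  open import Data.Nat.Properties using (n<1+n; <-irrefl)
  
  irr : ∀ {u} → ¬ PathAdj u u
  irr (Data.Sum.inj₁ e) = <-irrefl e (n<1+n _)
  irr (Data.Sum.inj₂ e) = <-irrefl e (n<1+n _)

_□_ : Graph → Graph → Graph
G □ H = record
  { V = V G × V H
  ; Adj = A
  ; adj-sym = s
  ; irrefl = i
  }
  where
  A : V G × V H → V G × V H → Set
  A (g , h) (g' , h') = (g ≡ g' × Adj H h h') ⊎ (Adj G g g' × h ≡ h')
  s : ∀ {u v} → A u v → A v u
  s (Data.Sum.inj₁ (Relation.Binary.PropositionalEquality.refl , a)) =
    Data.Sum.inj₁ (Relation.Binary.PropositionalEquality.refl , Graph.adj-sym H a)
  s (Data.Sum.inj₂ (a , Relation.Binary.PropositionalEquality.refl)) =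
    Data.Sum.inj₂ (Graph.adj-sym G a , Relation.Binary.PropositionalEquality.refl)
  i : ∀ {u} → ¬ A u u
  i (Data.Sum.inj₁ (_ , a)) = irrefl H a
  i (Data.Sum.inj₂ (a , _)) = irrefl G a

module _ (G : Graph) where

  data Walk : V G → V G → Set where
    nil  : ∀ {u} → Walk u u
    cons : ∀ {u w v} → Adj G u w → Walk w v → Walk u v

  vertices : ∀ {u v} → Walk u v → List (V G)
  vertices (nil {u}) = u ∷ []
  vertices (cons {u} _ w) = u ∷ vertices w

  edges : ∀ {u v} → Walk u v → List (V G × V G)
  edges nil = []
  edges (cons {u} {w} _ p) = (u , w) ∷ edges p

  IsPath : ∀ {u v} → Walk u v → Set
  IsPath p = Unique (vertices p)

  -- Two ordered pairs represent the same (undirected) edge.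
  SameEdge : V G × V G → V G × V G → Set
  SameEdge (a , b) (c , d) = (a ≡ c × b ≡ d) ⊎ (a ≡ d × b ≡ c)

  EdgeDisjoint : ∀ {u v u' v'} → Walk u v → Walk u' v' → Set
  EdgeDisjoint p q = ∀ e f → e ∈ edges p → f ∈ edges q → ¬ SameEdge e f

  -- A K_t-immersion in G: an injective map of the t vertices of K_t into G and,
  -- for every edge {i,j} of K_t (written with i < j), a path in G joining the
  -- images, such that paths for distinct edges are edge-disjoint.
  record KImmersion (t : ℕ) : Set where
    field
      φ        : Fin t → V G
      φ-inj    : Injective _≡_ _≡_ φ
      path     : (i j : Fin t) → i < j → Walk (φ i) (φ j)
      path-ok  : (i j : Fin t) (p : i < j) → IsPath (path i j p)
      disjoint : (i j k l : Fin t) (p : i < j) (q : k < l) →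
                 ¬ (i ≡ k × j ≡ l) → EdgeDisjoint (path i j p) (path k l q)

  ImmersionNumberIs : ℕ → Set
  ImmersionNumberIs m = KImmersion m × (∀ t → KImmersion t → t ≤ m)

-- A vertex of P₆ □ P₆ has degree at most 4. In a K_t-immersion the t − 1 paths
-- leaving a branch vertex must start along pairwise distinct edges, so t ≤ 5.
-- Conversely, five branch vertices around the centre of the 6 × 6 grid can be
-- joined by ten pairwise edge-disjoint paths; this is checked by computation.
module Submission where

open import Data.Empty using (⊥-elim)
open import Data.Fin using (Fin; zero; suc; toℕ; #_; _<_; _↑ˡ_; _↑ʳ_; splitAt)
open import Data.Fin.Properties as Finₚ
  using (toℕ-injective; suc-injective; ↑ˡ-injective; ↑ʳ-injective; splitAt-↑ˡ; splitAt-↑ʳ; pigeonhole; <⇒≢)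
open import Data.List using (List; []; _∷_; _++_)
open import Data.List.Membership.Propositional using (_∈_)
open import Data.List.Relation.Unary.All as All using (All)
open import Data.List.Relation.Unary.Any using (here)
open import Data.List.Relation.Unary.Unique.Propositional using (Unique)
import Data.List.Relation.Unary.Unique.DecPropositional as UniqueDec
open import Data.Nat as ℕ using (ℕ; _+_; _≤_; z≤n; s≤s; z<s)
open import Data.Nat.Properties as ℕₚ using (≮⇒≥)
open import Data.Product using (Σ; ∃; _×_; _,_; proj₁; proj₂)
open import Data.Product.Properties using (≡-dec)
open import Data.Sum using (inj₁; inj₂)
import Data.Vec as Vec
open import Function using (case_of_)
open import Relation.Binary.Definitions using (DecidableEquality)
open import Relation.Binary.PropositionalEquality
open import Relation.Nullary using (Dec; ¬_; ¬?)
open import Relation.Nullary.Decidable using (_×-dec_; _⊎-dec_; _→-dec_; from-yes)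

open import Defs

-- Distinct neighbours of a vertex receive distinct ports, so every degree is at most d.
record PortNumbering (G : Graph) (d : ℕ) : Set where
  field
    port           : ∀ {u w} → Adj G u w → Fin d
    port-injective : ∀ {u w w′} (a : Adj G u w) (b : Adj G u w′) → port a ≡ port b → w ≡ w′

open PortNumbering

pathGraph-portNumbering : ∀ n → PortNumbering (PathGraph n) 2
pathGraph-portNumbering n = record { port = direction ; port-injective = direction-injective }
  where
  direction : ∀ {i j : Fin n} → PathAdj i j → Fin 2
  direction (inj₁ _) = # 0
  direction (inj₂ _) = # 1

  direction-injective : ∀ {i j j′ : Fin n} (a : PathAdj i j) (b : PathAdj i j′) →
                        direction a ≡ direction b → j ≡ j′
  direction-injective (inj₁ up) (inj₁ up′) _ = toℕ-injective (trans up (sym up′))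
  direction-injective (inj₂ dn) (inj₂ dn′) _ = toℕ-injective (ℕₚ.suc-injective (trans (sym dn) dn′))
  direction-injective (inj₁ _)  (inj₂ _)   ()
  direction-injective (inj₂ _)  (inj₁ _)   ()

↑ˡ≢↑ʳ : ∀ {m n} (i : Fin m) (j : Fin n) → i ↑ˡ n ≢ m ↑ʳ j
↑ˡ≢↑ʳ {m} {n} i j eq with trans (sym (splitAt-↑ˡ m i n)) (trans (cong (splitAt m) eq) (splitAt-↑ʳ m n j))
... | ()

□-portNumbering : ∀ {G H a b} → PortNumbering G a → PortNumbering H b → PortNumbering (G □ H) (a + b)
□-portNumbering {G} {H} {a} {b} PG PH = record { port = port′ ; port-injective = port′-injective }
  where
  port′ : ∀ {u w} → Adj (G □ H) u w → Fin (a + b)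
  port′ (inj₁ (_ , h)) = a ↑ʳ port PH h
  port′ (inj₂ (g , _)) = port PG g ↑ˡ b

  port′-injective : ∀ {u w w′} (x : Adj (G □ H) u w) (y : Adj (G □ H) u w′) → port′ x ≡ port′ y → w ≡ w′
  port′-injective (inj₁ (refl , h)) (inj₁ (refl , h′)) eq =
    cong (_ ,_) (port-injective PH h h′ (↑ʳ-injective a _ _ eq))
  port′-injective (inj₂ (g , refl)) (inj₂ (g′ , refl)) eq =
    cong (_, _) (port-injective PG g g′ (↑ˡ-injective b _ _ eq))
  port′-injective (inj₁ (_ , h)) (inj₂ (g , _)) eq = ⊥-elim (↑ˡ≢↑ʳ _ _ (sym eq))
  port′-injective (inj₂ (g , _)) (inj₁ (_ , h)) eq = ⊥-elim (↑ˡ≢↑ʳ _ _ eq)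

firstEdge : ∀ {G u v} (p : Walk G u v) → u ≢ v → ∃ λ w → Σ (Adj G u w) λ _ → (u , w) ∈ edges G p
firstEdge nil        u≢v = ⊥-elim (u≢v refl)
firstEdge (cons a _) _   = _ , a , here refl

immersion-size≤ : ∀ {G d t} → PortNumbering G d → KImmersion G t → t ≤ ℕ.suc d
immersion-size≤ {t = ℕ.zero} _ _ = z≤n
immersion-size≤ {G} {d} {ℕ.suc t} P K = s≤s (≮⇒≥ crowded)
  where
  open KImmersion K

  leave : ∀ k → ∃ λ w → Σ (Adj G (φ zero) w) λ _ → (φ zero , w) ∈ edges G (path zero (suc k) z<s)
  leave k = firstEdge (path zero (suc k) z<s) (λ eq → case φ-inj eq of λ ())

  exitPort : Fin t → Fin d
  exitPort k = port P (proj₁ (proj₂ (leave k)))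

  crowded : ¬ d ℕ.< t
  crowded d<t =
    let i , j , i<j , samePort = pigeonhole d<t exitPort
        _ , aᵢ , aᵢ∈pathᵢ = leave i
        _ , aⱼ , aⱼ∈pathⱼ = leave j
    in disjoint zero (suc i) zero (suc j) z<s z<s (λ (_ , eq) → <⇒≢ i<j (suc-injective eq))
         _ _ aᵢ∈pathᵢ aⱼ∈pathⱼ (inj₁ (refl , port-injective P aᵢ aⱼ samePort))

module _ (G : Graph) where

  Chain : V G → List (V G) → V G → Set
  Chain u []       v = Adj G u v
  Chain u (w ∷ ws) v = Adj G u w × Chain w ws v

  walkAlong : ∀ u ws v → Chain u ws v → Walk G u v
  walkAlong u []       v a       = cons a nil
  walkAlong u (w ∷ ws) v (a , c) = cons a (walkAlong w ws v c)

  steps : V G → List (V G) → List (V G × V G)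
  steps u []       = []
  steps u (w ∷ ws) = (u , w) ∷ steps w ws

  edgesAlong : V G → List (V G) → V G → List (V G × V G)
  edgesAlong u ws v = steps u (ws ++ v ∷ [])

  vertices-walkAlong : ∀ u ws v c → vertices G (walkAlong u ws v c) ≡ u ∷ ws ++ v ∷ []
  vertices-walkAlong u []       v _       = refl
  vertices-walkAlong u (w ∷ ws) v (_ , c) = cong (u ∷_) (vertices-walkAlong w ws v c)

  edges-walkAlong : ∀ u ws v c → edges G (walkAlong u ws v c) ≡ edgesAlong u ws v
  edges-walkAlong u []       v _       = refl
  edges-walkAlong u (w ∷ ws) v (_ , c) = cong ((u , w) ∷_) (edges-walkAlong w ws v c)

  NoCommonEdge : List (V G × V G) → List (V G × V G) → Set
  NoCommonEdge es fs = All (λ e → All (λ f → ¬ SameEdge G e f) fs) es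

  noCommonEdge⇒edgeDisjoint : ∀ {u v u′ v′} (p : Walk G u v) (q : Walk G u′ v′) →
                              NoCommonEdge (edges G p) (edges G q) → EdgeDisjoint G p q
  noCommonEdge⇒edgeDisjoint _ _ none e f e∈p f∈q = All.lookup (All.lookup none e∈p) f∈q

  module Decide (_≟_ : DecidableEquality (V G)) (adj? : ∀ u v → Dec (Adj G u v)) where

    chain? : ∀ u ws v → Dec (Chain u ws v)
    chain? u []       v = adj? u v
    chain? u (w ∷ ws) v = adj? u w ×-dec chain? w ws v

    sameEdge? : ∀ e f → Dec (SameEdge G e f)
    sameEdge? (a , b) (c , d) = ((a ≟ c) ×-dec (b ≟ d)) ⊎-dec ((a ≟ d) ×-dec (b ≟ c))

    noCommonEdge? : ∀ es fs → Dec (NoCommonEdge es fs)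
    noCommonEdge? es fs = All.all? (λ e → All.all? (λ f → ¬? (sameEdge? e f)) fs) es

    open UniqueDec _≟_ public using (unique?)

-- An immersion given by its branch vertices and, for i < j, the inner vertices of the path from hub i to hub j.
record RoutedImmersion (G : Graph) (t : ℕ) : Set where
  field
    hub            : Fin t → V G
    route          : Fin t → Fin t → List (V G)
    hub-injective  : ∀ i j → hub i ≡ hub j → i ≡ j
    route-chain    : ∀ i j → i < j → Chain G (hub i) (route i j) (hub j)
    route-unique   : ∀ i j → i < j → Unique (hub i ∷ route i j ++ hub j ∷ [])
    route-disjoint : ∀ i j k l → i < j → k < l → ¬ (i ≡ k × j ≡ l) →
                     NoCommonEdge G (edgesAlong G (hub i) (route i j) (hub j))
                                    (edgesAlong G (hub k) (route k l) (hub l))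

routedImmersion⇒immersion : ∀ {G t} → RoutedImmersion G t → KImmersion G t
routedImmersion⇒immersion {G} R = record
  { φ        = hub
  ; φ-inj    = λ {i} {j} → hub-injective i j
  ; path     = link
  ; path-ok  = λ i j i<j →
      subst Unique (sym (vertices-walkAlong G _ _ _ (route-chain i j i<j))) (route-unique i j i<j)
  ; disjoint = λ i j k l i<j k<l ≢ → noCommonEdge⇒edgeDisjoint G (link i j i<j) (link k l k<l)
      (subst₂ (NoCommonEdge G) (sym (edges-walkAlong G _ _ _ (route-chain i j i<j)))
                               (sym (edges-walkAlong G _ _ _ (route-chain k l k<l)))
                               (route-disjoint i j k l i<j k<l ≢))
  }
  where
  open RoutedImmersion R

  link : ∀ i j → i < j → Walk G (hub i) (hub j)
  link i j i<j = walkAlong G (hub i) (route i j) (hub j) (route-chain i j i<j)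

pathGraph-adj? : ∀ {n} (i j : Fin n) → Dec (PathAdj i j)
pathGraph-adj? i j = (toℕ j ℕ.≟ ℕ.suc (toℕ i)) ⊎-dec (toℕ i ℕ.≟ ℕ.suc (toℕ j))

□-adj? : ∀ {G H} → DecidableEquality (V G) → DecidableEquality (V H) →
         (∀ g g′ → Dec (Adj G g g′)) → (∀ h h′ → Dec (Adj H h h′)) →
         ∀ u w → Dec (Adj (G □ H) u w)
□-adj? _≟G_ _≟H_ adjG? adjH? (g , h) (g′ , h′) =
  ((g ≟G g′) ×-dec adjH? h h′) ⊎-dec (adjG? g g′ ×-dec (h ≟H h′))

Grid : Graph
Grid = PathGraph 6 □ PathGraph 6

_≟_ : DecidableEquality (V Grid)
_≟_ = ≡-dec Finₚ._≟_ Finₚ._≟_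

open Decide Grid _≟_ (□-adj? {PathGraph 6} {PathGraph 6} Finₚ._≟_ Finₚ._≟_ pathGraph-adj? pathGraph-adj?)

gridHub : Fin 5 → V Grid
gridHub = Vec.lookup ((# 2 , # 1) Vec.∷ (# 1 , # 2) Vec.∷ (# 3 , # 3) Vec.∷ (# 2 , # 4) Vec.∷ (# 4 , # 3) Vec.∷ Vec.[])

-- Only the entries with i < j are used.
gridRoute : ℕ → ℕ → List (V Grid)
gridRoute 0 1 = (# 1 , # 1) ∷ []
gridRoute 0 2 = (# 2 , # 0) ∷ (# 3 , # 0) ∷ (# 3 , # 1) ∷ (# 3 , # 2) ∷ []
gridRoute 0 3 = (# 2 , # 2) ∷ (# 2 , # 3) ∷ []
gridRoute 0 4 = (# 3 , # 1) ∷ (# 4 , # 1) ∷ (# 5 , # 1) ∷ (# 5 , # 2) ∷ (# 5 , # 3) ∷ []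
gridRoute 1 2 = (# 1 , # 3) ∷ (# 2 , # 3) ∷ []
gridRoute 1 3 = (# 0 , # 2) ∷ (# 0 , # 3) ∷ (# 1 , # 3) ∷ (# 1 , # 4) ∷ []
gridRoute 1 4 = (# 2 , # 2) ∷ (# 3 , # 2) ∷ (# 4 , # 2) ∷ []
gridRoute 2 3 = (# 3 , # 4) ∷ (# 3 , # 5) ∷ (# 2 , # 5) ∷ []
gridRoute 3 4 = (# 3 , # 4) ∷ (# 4 , # 4) ∷ []
gridRoute _ _ = []

K₅-immersion : KImmersion Grid 5
K₅-immersion = routedImmersion⇒immersion record
  { hub            = gridHub
  ; route          = route
  ; hub-injective  = from-yes (Finₚ.all? λ i → Finₚ.all? λ j → (gridHub i ≟ gridHub j) →-dec (i Finₚ.≟ j))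
  ; route-chain    = from-yes (Finₚ.all? λ i → Finₚ.all? λ j →
                       (i Finₚ.<? j) →-dec chain? (gridHub i) (route i j) (gridHub j))
  ; route-unique   = from-yes (Finₚ.all? λ i → Finₚ.all? λ j →
                       (i Finₚ.<? j) →-dec unique? (gridHub i ∷ route i j ++ gridHub j ∷ []))
  ; route-disjoint = from-yes (Finₚ.all? λ i → Finₚ.all? λ j → Finₚ.all? λ k → Finₚ.all? λ l →
                       (i Finₚ.<? j) →-dec (k Finₚ.<? l) →-dec ¬? ((i Finₚ.≟ k) ×-dec (j Finₚ.≟ l)) →-dec
                       noCommonEdge? (edgesAlong Grid (gridHub i) (route i j) (gridHub j))
                                     (edgesAlong Grid (gridHub k) (route k l) (gridHub l)))
  }
  where
  route : Fin 5 → Fin 5 → List (V Grid)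
  route i j = gridRoute (toℕ i) (toℕ j)

proposition17 : ImmersionNumberIs (PathGraph 6 □ PathGraph 6) 5
proposition17 =
  K₅-immersion ,
  λ t K → immersion-size≤ (□-portNumbering (pathGraph-portNumbering 6) (pathGraph-portNumbering 6)) K
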